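{- Let $G$ be a graph with maximum degree at least $2$ and let $v\in V(G)$. If $f(v)\neq 1$ for every $\gamma_R$-function $f$ on $G$, then $\gamma_R(G-E_v)>\gamma_R(G)$, where $E_v$ is the set of all edges incident to $v$. In particular, $b_R(G)\le \deg_G(v)\le \Delta(G)$.
   Context: All graphs are finite, simple and undirected. A Roman dominating function (RDF) on $G$ is a map $f:V(G)\to\{0,1,2\}$ such that every vertex with $f$-value $0$ has a neighbor with $f$-value $2$. Its weight is $\sum_v f(v)$; $\gamma_R(G)$ is the minimum weight of an RDF, and a $\gamma_R$-function is an RDF of weight $\gamma_R(G)$. For a graph $G$ with maximum degree $\Delta(G)\ge 2$, the Roman bondage number $b_R(G)$ is the minimum cardinality of a set $E_1\subseteq E(G)$ with $\gamma_R(G-E_1)>\gamma_R(G)$. -}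

module Defs where

open import Data.Nat using (ℕ; zero; suc; _+_; _≤_; _<_; _⊔_)
open import Data.Nat.Properties using (_<?_)
open import Data.Fin using (Fin; toℕ)
open import Data.Bool using (Bool; true; false; _∧_; not; if_then_else_)
open import Data.List using (List; map; foldr)
open import Data.Nat.ListAction using (sum)
open import Data.List.Base using (allFin)
open import Data.Product using (Σ; ∃; _×_; _,_)
open import Relation.Binary.PropositionalEquality using (_≡_; _≢_)
open import Relation.Nullary.Decidable using (⌊_⌋)

record Graph (n : ℕ) : Set where
  field
    adj   : Fin n → Fin n → Bool
    sym   : ∀ u v → adj u v ≡ adj v u
    irref : ∀ v → adj v v ≡ false
open Graph public

count : {n : ℕ} → (Fin n → Bool) → ℕ
count {n} p = sum (map (λ i → if p i then 1 else 0) (allFin n))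

deg : {n : ℕ} → Graph n → Fin n → ℕ
deg G v = count (adj G v)

maxDeg : {n : ℕ} → Graph n → ℕ
maxDeg {n} G = foldr _⊔_ 0 (map (deg G) (allFin n))

record EdgeSet {n : ℕ} (G : Graph n) : Set where
  field
    mem    : Fin n → Fin n → Bool
    memSym : ∀ u v → mem u v ≡ mem v u
    memSub : ∀ u v → mem u v ≡ true → adj G u v ≡ true
open EdgeSet public

-- number of edges in an edge set (each unordered pair {i,j}, i < j, counted once)
edgeCount : {n : ℕ} {G : Graph n} → EdgeSet G → ℕ
edgeCount {n} E =
  sum (map (λ i → count (λ j → ⌊ toℕ i <? toℕ j ⌋ ∧ mem E i j)) (allFin n))

private
  ∧-sym : ∀ a b c d → a ≡ b → c ≡ d → (a ∧ not c) ≡ (b ∧ not d)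
  ∧-sym a .a c .c _≡_.refl _≡_.refl = _≡_.refl

  ∧-irr : ∀ a c → a ≡ false → (a ∧ not c) ≡ false
  ∧-irr .false c _≡_.refl = _≡_.refl

removeEdges : {n : ℕ} (G : Graph n) → EdgeSet G → Graph n
removeEdges G E = record
  { adj   = λ u v → adj G u v ∧ not (mem E u v)
  ; sym   = λ u v → ∧-sym (adj G u v) (adj G v u) (mem E u v) (mem E v u)
                       (sym G u v) (memSym E u v)
  ; irref = λ v → ∧-irr (adj G v v) (mem E v v) (irref G v)
  }

open import Data.Fin using (_≟_)
open import Data.Bool using (_∨_)

incidentEdges : {n : ℕ} (G : Graph n) → Fin n → EdgeSet G
incidentEdges G v = record
  { mem    = λ a b → adj G a b ∧ (⌊ a ≟ v ⌋ ∨ ⌊ b ≟ v ⌋)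
  ; memSym = λ a b → lemSym (adj G a b) (adj G b a) ⌊ a ≟ v ⌋ ⌊ b ≟ v ⌋ (sym G a b)
  ; memSub = λ a b → lemSub (adj G a b) (⌊ a ≟ v ⌋ ∨ ⌊ b ≟ v ⌋)
  }
  where
  lemSym : ∀ x y p q → x ≡ y → (x ∧ (p ∨ q)) ≡ (y ∧ (q ∨ p))
  lemSym x .x false false _≡_.refl = _≡_.refl
  lemSym x .x false true  _≡_.refl = _≡_.refl
  lemSym x .x true  false _≡_.refl = _≡_.refl
  lemSym x .x true  true  _≡_.refl = _≡_.refl
  lemSub : ∀ x p → (x ∧ p) ≡ true → x ≡ true
  lemSub true p _ = _≡_.refl
  lemSub false p ()

weight : {n : ℕ} → (Fin n → Fin 3) → ℕ
weight {n} f = sum (map (λ i → toℕ (f i)) (allFin n))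

IsRDF : {n : ℕ} → Graph n → (Fin n → Fin 3) → Set
IsRDF G f = ∀ v → toℕ (f v) ≡ 0 →
  ∃ λ u → adj G u v ≡ true × toℕ (f u) ≡ 2

IsγRFunction : {n : ℕ} → Graph n → (Fin n → Fin 3) → Set
IsγRFunction G f = IsRDF G f × (∀ g → IsRDF G g → weight f ≤ weight g)

IsγR : {n : ℕ} → Graph n → ℕ → Set
IsγR G k = (∃ λ f → IsRDF G f × weight f ≡ k) × (∀ g → IsRDF G g → k ≤ weight g)

IncreasesγR : {n : ℕ} (G : Graph n) → EdgeSet G → Set
IncreasesγR G E₁ = ∀ k k′ → IsγR G k → IsγR (removeEdges G E₁) k′ → k < k′

IsRomanBondage : {n : ℕ} → Graph n → ℕ → Set
IsRomanBondage G b =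
  (∃ λ (E₁ : EdgeSet G) → edgeCount E₁ ≡ b × IncreasesγR G E₁)
  × (∀ (E₁ : EdgeSet G) → IncreasesγR G E₁ → b ≤ edgeCount E₁)

-- Deleting the edges at v isolates v, and in a graph where v is isolated every
-- γ_R-function labels v with 1: label 0 leaves v undominated, and label 2 could be
-- lowered to 1.  So if γ_R(G - E_v) = γ_R(G), a γ_R-function of G - E_v is one of G
-- labelling v with 1, which the hypothesis forbids.  The bound b_R(G) ≤ deg v holds
-- because each edge of E_v contributes its other endpoint to the neighbourhood of v.
module Submission where

open import Defs hiding (sym)
open import Data.Nat using (ℕ; zero; suc; _+_; _≤_; _⊔_; z≤n)
open import Data.Nat.Properties
  using (+-0-commutativeMonoid; +-mono-≤; ≤-refl; ≤-reflexive; ≤-trans; ≤∧≢⇒<;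
         +-identityʳ; <-irrefl; <-asym; 1+n≰n; _<?_; m≤n⇒m≤n⊔o; m≤n⇒m≤o⊔n; module ≤-Reasoning)
open import Data.Fin using (Fin; toℕ; _≟_; punchIn)
open import Data.Fin.Patterns using (0F; 1F; 2F)
open import Data.Fin.Properties using (punchInᵢ≢i)
open import Data.Bool using (Bool; true; false; _∧_; if_then_else_)
open import Data.Bool.Properties using (∧-zeroʳ; ∧-identityʳ; ∧-inverseʳ; ∨-zeroʳ)
open import Data.List using (List; map; foldr; tabulate; allFin)
open import Data.List.Properties using (map-tabulate; foldr-preservesᵒ)
open import Data.List.Membership.Propositional using (_∈_)
open import Data.List.Membership.Propositional.Properties using (∈-map⁺; ∈-allFin)
import Data.List.Relation.Unary.Any as Any
open import Data.Nat.ListAction using (sum)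
open import Data.Product using (_×_; _,_; proj₂)
open import Data.Sum using (inj₂; [_,_])
open import Data.Vec.Functional using (removeAt; updateAt)
open import Data.Vec.Functional.Properties using (updateAt-updates; updateAt-minimal)
open import Algebra.Properties.CommutativeMonoid.Sum +-0-commutativeMonoid
  using (sum-cong-≗; sum-remove; sum-replicate-zero; ∑-distrib-+)
  renaming (sum to ∑)
open import Function using (_∘_; const)
open import Relation.Nullary using (Dec; yes; no; ¬_; contradiction)
open import Relation.Nullary.Decidable using (⌊_⌋; isYes≗does; dec-true; dec-false)
open import Relation.Binary.PropositionalEquality
  using (_≡_; _≢_; refl; sym; trans; cong; cong₂; subst; module ≡-Reasoning)

⌊⌋-yes : ∀ {a} {A : Set a} (a? : Dec A) → A → ⌊ a? ⌋ ≡ true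
⌊⌋-yes a? a = trans (isYes≗does a?) (dec-true a? a)

⌊⌋-no : ∀ {a} {A : Set a} (a? : Dec A) → ¬ A → ⌊ a? ⌋ ≡ false
⌊⌋-no a? ¬a = trans (isYes≗does a?) (dec-false a? ¬a)

indicator : Bool → ℕ
indicator b = if b then 1 else 0

sum-map-allFin : ∀ {n} (f : Fin n → ℕ) → sum (map f (allFin n)) ≡ ∑ f
sum-map-allFin {n} f = trans (cong sum (map-tabulate (λ i → i) f)) (sum-tabulate f)
  where
  sum-tabulate : ∀ {m} (g : Fin m → ℕ) → sum (tabulate g) ≡ ∑ g
  sum-tabulate {zero}  g = refl
  sum-tabulate {suc m} g = cong (g 0F +_) (sum-tabulate (g ∘ Fin.suc))

count-∑ : ∀ {n} (p : Fin n → Bool) → count p ≡ ∑ (indicator ∘ p)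
count-∑ p = sum-map-allFin (indicator ∘ p)

∑-mono-≤ : ∀ {n} {f g : Fin n → ℕ} → (∀ i → f i ≤ g i) → ∑ f ≤ ∑ g
∑-mono-≤ {zero}  f≤g = z≤n
∑-mono-≤ {suc n} f≤g = +-mono-≤ (f≤g 0F) (∑-mono-≤ (f≤g ∘ Fin.suc))

∑-concentrated : ∀ {n} (f : Fin n → ℕ) (v : Fin n) →
                 (∀ j → j ≢ v → f j ≡ 0) → ∑ f ≡ f v
∑-concentrated {suc n} f v vanishes = begin
  ∑ f                        ≡⟨ sum-remove f ⟩
  f v + ∑ (removeAt f v)     ≡⟨ cong (f v +_) (sum-cong-≗ λ j → vanishes (punchIn v j) (punchInᵢ≢i v j)) ⟩
  f v + ∑ {n} (λ _ → 0)      ≡⟨ cong (f v +_) (sum-replicate-zero n) ⟩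
  f v + 0                    ≡⟨ +-identityʳ (f v) ⟩
  f v                        ∎
  where open ≡-Reasoning

∑-differ-at : ∀ {n} (f g : Fin n → ℕ) (v : Fin n) →
              (∀ j → j ≢ v → f j ≡ g j) → f v ≡ suc (g v) → ∑ f ≡ suc (∑ g)
∑-differ-at {suc n} f g v agree fv≡1+gv = begin
  ∑ f                        ≡⟨ sum-remove f ⟩
  f v + ∑ (removeAt f v)     ≡⟨ cong₂ _+_ fv≡1+gv (sum-cong-≗ λ j → agree (punchIn v j) (punchInᵢ≢i v j)) ⟩
  suc (g v + ∑ (removeAt g v)) ≡⟨ cong suc (sym (sum-remove g)) ⟩
  suc (∑ g)                  ∎
  where open ≡-Reasoning

weight-∑ : ∀ {n} (f : Fin n → Fin 3) → weight f ≡ ∑ (toℕ ∘ f)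
weight-∑ f = sum-map-allFin (toℕ ∘ f)

≤-foldr-⊔ : ∀ {x} {xs : List ℕ} → x ∈ xs → x ≤ foldr _⊔_ 0 xs
≤-foldr-⊔ {x} {xs} x∈xs = foldr-preservesᵒ {P = x ≤_}
  (λ y z → [ m≤n⇒m≤n⊔o z , m≤n⇒m≤o⊔n y ]) 0 xs (inj₂ (Any.map ≤-reflexive x∈xs))

deg≤maxDeg : ∀ {n} (G : Graph n) (v : Fin n) → deg G v ≤ maxDeg G
deg≤maxDeg G v = ≤-foldr-⊔ (∈-map⁺ (deg G) (∈-allFin v))

module IncidentEdgeCount {n : ℕ} (G : Graph (suc n)) (v : Fin (suc n)) where

  countedPair : Fin (suc n) → Fin (suc n) → Bool
  countedPair i j = ⌊ toℕ i <? toℕ j ⌋ ∧ mem (incidentEdges G v) i j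

  incidentRow : Fin (suc n) → ℕ
  incidentRow i = count (countedPair i)

  neighbourAbove neighbourBelow : Fin (suc n) → ℕ
  neighbourAbove j = indicator (⌊ toℕ v <? toℕ j ⌋ ∧ adj G v j)
  neighbourBelow j = indicator (⌊ toℕ j <? toℕ v ⌋ ∧ adj G v j)

  incidentRow-self : incidentRow v ≡ ∑ neighbourAbove
  incidentRow-self = trans (count-∑ (countedPair v)) (sum-cong-≗ term)
    where
    term : ∀ j → indicator (countedPair v j) ≡ neighbourAbove j
    term j rewrite ⌊⌋-yes (v ≟ v) refl | ∧-identityʳ (adj G v j) = refl

  incidentRow-other : ∀ i → i ≢ v → incidentRow i ≡ neighbourBelow i
  incidentRow-other i i≢v = trans (count-∑ (countedPair i)) (trans (∑-concentrated _ v off-v) at-v)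
    where
    i≟v≡false : ⌊ i ≟ v ⌋ ≡ false
    i≟v≡false = ⌊⌋-no (i ≟ v) i≢v
    off-v : ∀ j → j ≢ v → indicator (countedPair i j) ≡ 0
    off-v j j≢v rewrite i≟v≡false | ⌊⌋-no (j ≟ v) j≢v
                      | ∧-zeroʳ (adj G i j) | ∧-zeroʳ ⌊ toℕ i <? toℕ j ⌋ = refl
    at-v : indicator (countedPair i v) ≡ neighbourBelow i
    at-v rewrite i≟v≡false | ⌊⌋-yes (v ≟ v) refl
               | ∧-identityʳ (adj G i v) | Graph.sym G i v = refl

  neighbourBelow-self : neighbourBelow v ≡ 0
  neighbourBelow-self rewrite ⌊⌋-no (toℕ v <? toℕ v) (<-irrefl refl) = refl

  ∑-incidentRow : ∑ incidentRow ≡ ∑ neighbourAbove + ∑ neighbourBelow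
  ∑-incidentRow = begin
    ∑ incidentRow
      ≡⟨ sum-remove incidentRow ⟩
    incidentRow v + ∑ (removeAt incidentRow v)
      ≡⟨ cong₂ _+_ incidentRow-self (sum-cong-≗ λ j → incidentRow-other (punchIn v j) (punchInᵢ≢i v j)) ⟩
    ∑ neighbourAbove + ∑ (removeAt neighbourBelow v)
      ≡⟨ cong (λ b → ∑ neighbourAbove + (b + ∑ (removeAt neighbourBelow v))) neighbourBelow-self ⟨
    ∑ neighbourAbove + (neighbourBelow v + ∑ (removeAt neighbourBelow v))
      ≡⟨ cong (∑ neighbourAbove +_) (sum-remove neighbourBelow) ⟨
    ∑ neighbourAbove + ∑ neighbourBelow
      ∎
    where open ≡-Reasoning

  -- The two indicators test the incompatible conditions v < j and j < v.
  neighbourAbove+Below≤adj : ∀ j → neighbourAbove j + neighbourBelow j ≤ indicator (adj G v j)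
  neighbourAbove+Below≤adj j with adj G v j
  ... | false rewrite ∧-zeroʳ ⌊ toℕ v <? toℕ j ⌋ | ∧-zeroʳ ⌊ toℕ j <? toℕ v ⌋ = z≤n
  ... | true with toℕ v <? toℕ j | toℕ j <? toℕ v
  ...   | yes v<j | yes j<v = contradiction j<v (<-asym v<j)
  ...   | yes _   | no _    = ≤-refl
  ...   | no _    | yes _   = ≤-refl
  ...   | no _    | no _    = z≤n

  edgeCount-incidentEdges≤deg : edgeCount (incidentEdges G v) ≤ deg G v
  edgeCount-incidentEdges≤deg = begin
    edgeCount (incidentEdges G v)                              ≡⟨ sum-map-allFin incidentRow ⟩
    ∑ incidentRow                                              ≡⟨ ∑-incidentRow ⟩
    ∑ neighbourAbove + ∑ neighbourBelow                        ≡⟨ ∑-distrib-+ neighbourAbove neighbourBelow ⟨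
    ∑ (λ j → neighbourAbove j + neighbourBelow j)              ≤⟨ ∑-mono-≤ neighbourAbove+Below≤adj ⟩
    ∑ (indicator ∘ adj G v)                                    ≡⟨ count-∑ (adj G v) ⟨
    deg G v                                                    ∎
    where open ≤-Reasoning

Isolated : ∀ {n} → Graph n → Fin n → Set
Isolated H v = ∀ w → adj H w v ≡ false

removeEdges-⊆ : ∀ {n} {G : Graph n} (E : EdgeSet G) {u w : Fin n} →
                adj (removeEdges G E) u w ≡ true → adj G u w ≡ true
removeEdges-⊆ {G = G} E {u} {w} with adj G u w
... | true  = λ _ → refl
... | false = λ ()

IsRDF-removeEdges⁻ : ∀ {n} {G : Graph n} (E : EdgeSet G) {f : Fin n → Fin 3} →
                     IsRDF (removeEdges G E) f → IsRDF G f
IsRDF-removeEdges⁻ E rdf u fu≡0 with rdf u fu≡0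
... | w , w~u , fw≡2 = w , removeEdges-⊆ E w~u , fw≡2

incidentEdges-isolates : ∀ {n} (G : Graph n) (v : Fin n) →
                         Isolated (removeEdges G (incidentEdges G v)) v
incidentEdges-isolates G v w
  rewrite ⌊⌋-yes (v ≟ v) refl | ∨-zeroʳ ⌊ w ≟ v ⌋ | ∧-identityʳ (adj G w v) =
  ∧-inverseʳ (adj G w v)

module _ {n : ℕ} (H : Graph n) (v : Fin n) (isolated : Isolated H v) where

  lowered : (Fin n → Fin 3) → Fin n → Fin 3
  lowered f = updateAt f v (const 1F)

  Isolated⇒label≢0 : ∀ {f} → IsRDF H f → toℕ (f v) ≢ 0
  Isolated⇒label≢0 rdf fv≡0 with rdf v fv≡0
  ... | w , w~v , _ = contradiction (trans (sym w~v) (isolated w)) λ ()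

  Isolated⇒lowered-IsRDF : ∀ {f} → IsRDF H f → IsRDF H (lowered f)
  Isolated⇒lowered-IsRDF {f} rdf u hu≡0 with u ≟ v
  ... | yes refl = contradiction (trans (cong toℕ (sym (updateAt-updates u f))) hu≡0) λ ()
  ... | no u≢v with rdf u (trans (cong toℕ (sym (updateAt-minimal u v f u≢v))) hu≡0)
  ...   | w , w~u , fw≡2 = w , w~u , trans (cong toℕ (updateAt-minimal w v f w≢v)) fw≡2
    where
    w≢v : w ≢ v
    w≢v refl = contradiction (trans (sym w~u) (trans (Graph.sym H w u) (isolated u))) λ ()

  weight-lowered : ∀ {f} → toℕ (f v) ≡ 2 → weight f ≡ suc (weight (lowered f))
  weight-lowered {f} fv≡2 = begin
    weight f                   ≡⟨ weight-∑ f ⟩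
    ∑ (toℕ ∘ f)                ≡⟨ ∑-differ-at _ _ v agree at-v ⟩
    suc (∑ (toℕ ∘ lowered f))  ≡⟨ cong suc (weight-∑ (lowered f)) ⟨
    suc (weight (lowered f))   ∎
    where
    open ≡-Reasoning
    agree : ∀ j → j ≢ v → toℕ (f j) ≡ toℕ (lowered f j)
    agree j j≢v = cong toℕ (sym (updateAt-minimal j v f j≢v))
    at-v : toℕ (f v) ≡ suc (toℕ (lowered f v))
    at-v = trans fv≡2 (cong (suc ∘ toℕ) (sym (updateAt-updates v f)))

  Isolated⇒γRFunction-label≡1 : ∀ {f} → IsγRFunction H f → toℕ (f v) ≡ 1
  Isolated⇒γRFunction-label≡1 {f} (rdf , minimal) with f v in fv≡
  ... | 0F = contradiction (cong toℕ fv≡) (Isolated⇒label≢0 rdf)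
  ... | 1F = refl
  ... | 2F = contradiction (subst (_≤ weight (lowered f)) (weight-lowered (cong toℕ fv≡))
                                 (minimal (lowered f) (Isolated⇒lowered-IsRDF rdf)))
                          1+n≰n

Isolated⇒removeEdges-increasesγR : ∀ {n} (G : Graph n) (E : EdgeSet G) (v : Fin n) →
  Isolated (removeEdges G E) v → (∀ f → IsγRFunction G f → toℕ (f v) ≢ 1) →
  IncreasesγR G E
Isolated⇒removeEdges-increasesγR G E v isolated never-1 _ _ ((f , _ , refl) , γR-min) ((g , g-rdf , refl) , γR′-min) =
  ≤∧≢⇒< (γR-min g g-rdf-G) λ wf≡wg →
    never-1 g (g-rdf-G , λ h h-rdf → subst (_≤ weight h) wf≡wg (γR-min h h-rdf))
              (Isolated⇒γRFunction-label≡1 (removeEdges G E) v isolated (g-rdf , γR′-min))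
  where
  g-rdf-G : IsRDF G g
  g-rdf-G = IsRDF-removeEdges⁻ E g-rdf

edgeCount-incidentEdges≤deg : ∀ {n} (G : Graph n) (v : Fin n) → edgeCount (incidentEdges G v) ≤ deg G v
edgeCount-incidentEdges≤deg {suc n} G v = IncidentEdgeCount.edgeCount-incidentEdges≤deg G v

-- The hypothesis Δ(G) ≥ 2 only guarantees that b_R(G) is defined; IsRomanBondage is a relation.
mainTheorem4 : {n : ℕ} (G : Graph n) → 2 ≤ maxDeg G → (v : Fin n) →
    (∀ f → IsγRFunction G f → toℕ (f v) ≢ 1) →
    IncreasesγR G (incidentEdges G v)
    × (∀ b → IsRomanBondage G b → b ≤ deg G v)
    × deg G v ≤ maxDeg G
mainTheorem4 G _ v never-1 =
    removing-Eᵥ-increases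
  , (λ b bondage → ≤-trans (proj₂ bondage (incidentEdges G v) removing-Eᵥ-increases)
                            (edgeCount-incidentEdges≤deg G v))
  , deg≤maxDeg G v
  where
  removing-Eᵥ-increases : IncreasesγR G (incidentEdges G v)
  removing-Eᵥ-increases = Isolated⇒removeEdges-increasesγR G (incidentEdges G v) v (incidentEdges-isolates G v) never-1
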